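{- Every cubic graph $G$ with $n$ vertices satisfies $\gamma_I^p(G)\le n-2\,\mathrm{im}(G)$.
   Context: A cubic graph is a 3-regular simple graph. A strong (induced) matching of $G$ is a set $M$ of edges, pairwise vertex-disjoint, such that no edge of $G$ joins a vertex of one edge of $M$ to a vertex of another edge of $M$; $\mathrm{im}(G)$ is the maximum size of a strong matching. For $v\in V(G)$, $N(v)$ is its set of neighbours. A perfect Italian dominating function (PID-function) of $G$ is a function $f:V\to\{0,1,2\}$ such that for every vertex $v$ with $f(v)=0$ one has $\sum_{u\in N(v)} f(u)=2$. The weight of $f$ is $\sum_{v\in V} f(v)$; $\gamma_I^p(G)$ is the minimum weight of a PID-function of $G$. -}

module Defs where

open import Data.Nat using (ℕ; _≤_)
open import Data.Bool using (Bool; true; false; if_then_else_)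
open import Data.Fin using (Fin)
open import Data.List using (List; map; allFin)
open import Data.Nat.ListAction using (sum)
open import Data.Sum using (_⊎_)
open import Data.Product using (_×_; proj₁; proj₂)
open import Relation.Binary.PropositionalEquality using (_≡_; _≢_)
open import Relation.Nullary using (¬_)

record Graph (n : ℕ) : Set where
  field
    adj   : Fin n → Fin n → Bool
    irrefl : ∀ v → adj v v ≡ false
    sym    : ∀ u v → adj u v ≡ adj v u

open Graph public

Adj : ∀ {n} → Graph n → Fin n → Fin n → Set
Adj G u v = adj G u v ≡ true

degree : ∀ {n} → Graph n → Fin n → ℕ
degree {n} G v = sum (map (λ u → if adj G v u then 1 else 0) (allFin n))

Cubic : ∀ {n} → Graph n → Set
Cubic G = ∀ v → degree G v ≡ 3

nbSum : ∀ {n} → Graph n → (Fin n → ℕ) → Fin n → ℕ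
nbSum {n} G f v = sum (map (λ u → if adj G v u then f u else 0) (allFin n))

weight : ∀ {n} → (Fin n → ℕ) → ℕ
weight {n} f = sum (map f (allFin n))

record IsPID {n} (G : Graph n) (f : Fin n → ℕ) : Set where
  field
    range : ∀ v → f v ≤ 2
    perfect : ∀ v → f v ≡ 0 → nbSum G f v ≡ 2

record IsStrongMatching {n k} (G : Graph n) (M : Fin k → Fin n × Fin n) : Set where
  field
    edge : ∀ i → Adj G (proj₁ (M i)) (proj₂ (M i))
    disjoint : ∀ i j → i ≢ j → ∀ (x y : Fin n) →
               (x ≡ proj₁ (M i) ⊎ x ≡ proj₂ (M i)) →
               (y ≡ proj₁ (M j) ⊎ y ≡ proj₂ (M j)) →
               x ≢ y
    induced : ∀ i j → i ≢ j → ∀ (x y : Fin n) →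
               (x ≡ proj₁ (M i) ⊎ x ≡ proj₂ (M i)) →
               (y ≡ proj₁ (M j) ⊎ y ≡ proj₂ (M j)) →
               ¬ Adj G x y

-- Let f be the indicator function of the vertices not covered by a strong
-- matching M, so f has weight n − 2|M|. A vertex v with f v = 0 lies on an
-- edge vp of M. Since M is induced, no neighbour of v other than p is
-- covered, so in a cubic graph v sees exactly 3 − 1 = 2 vertices of weight 1.
module Submission where

open import Defs hiding (sym)
open import Data.Nat using (ℕ; zero; suc; _+_; _*_; _∸_; _≤_; z≤n; s≤s)
open import Data.Nat.Properties
  using (+-0-commutativeMonoid; +-identityʳ; +-cancelʳ-≡; *-comm; *-identityʳ; m+n∸n≡m; m∸n≤m; m∸n+n≡m; ≤-trans; ≤-reflexive)
import Data.Nat.Properties as ℕ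
import Data.Nat.ListAction as List
open import Data.Bool using (true; false; if_then_else_)
open import Data.Fin using (Fin; zero; suc; punchIn)
open import Data.Fin.Properties using (_≟_; punchInᵢ≢i; ¬∀⟶∃¬)
open import Data.List using (map; allFin; tabulate)
open import Data.List.Properties using (map-tabulate)
open import Data.Product using (_×_; Σ; ∃-syntax; _,_; proj₁; proj₂; map₂)
open import Data.Sum using (_⊎_; inj₁; inj₂)
open import Data.Vec.Functional using (Vector)
open import Function using (_∘_)
open import Relation.Nullary using (yes; no; does; contradiction)
open import Relation.Binary.PropositionalEquality
open import Algebra.Properties.CommutativeMonoid.Sum +-0-commutativeMonoid
  using (sum; sum-syntax; sum-cong-≗; sum-remove; sum-replicate-zero; ∑-distrib-+; ∑-comm)

private
  variable
    n k : ℕ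

List-sum-tabulate : (h : Vector ℕ n) → List.sum (tabulate h) ≡ sum h
List-sum-tabulate {zero}  h = refl
List-sum-tabulate {suc n} h = cong (h zero +_) (List-sum-tabulate (h ∘ suc))

List-sum-allFin : (h : Vector ℕ n) → List.sum (map h (allFin n)) ≡ sum h
List-sum-allFin h = trans (cong List.sum (map-tabulate (λ i → i) h)) (List-sum-tabulate h)

∑-const : ∀ n (c : ℕ) → ∑[ i < n ] c ≡ n * c
∑-const zero    c = refl
∑-const (suc n) c = cong (c +_) (∑-const n c)

∑-zero : (h : Vector ℕ n) → (∀ i → h i ≡ 0) → sum h ≡ 0
∑-zero {n} h h≡0 = trans (sum-cong-≗ h≡0) (sum-replicate-zero n)

∑-nonzero : (h : Vector ℕ n) → sum h ≢ 0 → ∃[ i ] h i ≢ 0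
∑-nonzero {n} h ∑h≢0 = ¬∀⟶∃¬ n (λ i → h i ≡ 0) (λ i → h i ℕ.≟ 0) (∑h≢0 ∘ ∑-zero h)

∑-single : (h : Vector ℕ n) (i : Fin n) → (∀ j → j ≢ i → h j ≡ 0) → sum h ≡ h i
∑-single {suc _} h i rest≡0 = begin
  sum h                             ≡⟨ sum-remove {i = i} h ⟩
  h i + ∑[ j < _ ] h (punchIn i j)  ≡⟨ cong (h i +_) (∑-zero _ (λ j → rest≡0 _ (punchInᵢ≢i i j))) ⟩
  h i + 0                           ≡⟨ +-identityʳ (h i) ⟩
  h i                               ∎
  where open ≡-Reasoning

∑-≤-single : ∀ {c} (h : Vector ℕ n) → (∀ i → h i ≤ c) →
             (∀ i j → h i ≢ 0 → h j ≢ 0 → i ≡ j) → sum h ≤ c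
∑-≤-single h h≤c unique with sum h ℕ.≟ 0
... | yes ∑h≡0 = subst (_≤ _) (sym ∑h≡0) z≤n
... | no ∑h≢0 with ∑-nonzero h ∑h≢0
... | i , hi≢0 = subst (_≤ _) (sym (∑-single h i others≡0)) (h≤c i)
  where
  others≡0 : ∀ j → j ≢ i → h j ≡ 0
  others≡0 j j≢i with h j ℕ.≟ 0
  ... | yes hj≡0 = hj≡0
  ... | no hj≢0 = contradiction (unique j i hj≢0 hi≢0) j≢i

δ : Fin n → Fin n → ℕ
δ u c = if does (u ≟ c) then 1 else 0

δ-≢ : {u c : Fin n} → u ≢ c → δ u c ≡ 0
δ-≢ {u = u} {c} u≢c with u ≟ c
... | yes u≡c = contradiction u≡c u≢c
... | no _    = refl

δ-refl : (c : Fin n) → δ c c ≡ 1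
δ-refl c with c ≟ c
... | yes _   = refl
... | no c≢c = contradiction refl c≢c

δ-≤1 : (u c : Fin n) → δ u c ≤ 1
δ-≤1 u c with u ≟ c
... | yes _ = s≤s z≤n
... | no _  = z≤n

δ-+-nonzero : (u a b : Fin n) → δ u a + δ u b ≢ 0 → u ≡ a ⊎ u ≡ b
δ-+-nonzero u a b δ≢0 with u ≟ a | u ≟ b
... | yes u≡a | _       = inj₁ u≡a
... | no _    | yes u≡b = inj₂ u≡b
... | no _    | no _    = contradiction refl δ≢0

∑-δ : (c : Fin n) → ∑[ u < n ] δ u c ≡ 1
∑-δ c = trans (∑-single (λ u → δ u c) c (λ _ → δ-≢)) (δ-refl c)

adj-≢ : (G : Graph n) {u v : Fin n} → Adj G u v → u ≢ v
adj-≢ G {u} uv refl = contradiction (trans (sym uv) (irrefl G u)) λ ()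

nbSum-∑ : (G : Graph n) (f : Vector ℕ n) (v : Fin n) →
          nbSum G f v ≡ ∑[ u < n ] (if adj G v u then f u else 0)
nbSum-∑ G f v = List-sum-allFin (λ u → if adj G v u then f u else 0)

nbSum-δ : (G : Graph n) {v p : Fin n} → Adj G v p → nbSum G (λ u → δ u p) v ≡ 1
nbSum-δ {n} G {v} {p} vp = begin
  nbSum G (λ u → δ u p) v                          ≡⟨ nbSum-∑ G _ v ⟩
  ∑[ u < n ] (if adj G v u then δ u p else 0)      ≡⟨ ∑-single _ p off-p ⟩
  (if adj G v p then δ p p else 0)                 ≡⟨ cong (λ b → if b then δ p p else 0) vp ⟩
  δ p p                                            ≡⟨ δ-refl p ⟩
  1                                                ∎
  where
  open ≡-Reasoning
  off-p : ∀ u → u ≢ p → (if adj G v u then δ u p else 0) ≡ 0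
  off-p u u≢p with adj G v u
  ... | true  = δ-≢ u≢p
  ... | false = refl

nbSum-complement : (G : Graph n) (f g : Vector ℕ n) (v : Fin n) →
                   (∀ u → Adj G v u → f u + g u ≡ 1) →
                   nbSum G f v + nbSum G g v ≡ degree G v
nbSum-complement {n} G f g v f+g≡1 = begin
  nbSum G f v + nbSum G g v                ≡⟨ cong₂ _+_ (nbSum-∑ G f v) (nbSum-∑ G g v) ⟩
  sum f|N + sum g|N                        ≡⟨ sym (∑-distrib-+ f|N g|N) ⟩
  ∑[ u < n ] (f|N u + g|N u)               ≡⟨ sum-cong-≗ pointwise ⟩
  ∑[ u < n ] (if adj G v u then 1 else 0)  ≡⟨ sym (List-sum-allFin (λ u → if adj G v u then 1 else 0)) ⟩
  degree G v                               ∎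
  where
  open ≡-Reasoning
  f|N g|N : Vector ℕ n
  f|N u = if adj G v u then f u else 0
  g|N u = if adj G v u then g u else 0
  pointwise : ∀ u → f|N u + g|N u ≡ (if adj G v u then 1 else 0)
  pointwise u with adj G v u in vu
  ... | true  = f+g≡1 u vu
  ... | false = refl

module Uncovered {G : Graph n} {M : Fin k → Fin n × Fin n} (strong : IsStrongMatching G M) where
  open IsStrongMatching strong

  a b : Fin k → Fin n
  a j = proj₁ (M j)
  b j = proj₂ (M j)

  Endpoint : Fin n → Fin k → Set
  Endpoint u j = u ≡ a j ⊎ u ≡ b j

  cover : Fin n → Fin k → ℕ
  cover u j = δ u (a j) + δ u (b j)

  -- Counting coverage with Kronecker deltas makes ∑ covered = 2k a swap of two finite sums.
  covered : Fin n → ℕ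
  covered u = ∑[ j < k ] cover u j

  uncovered : Fin n → ℕ
  uncovered u = 1 ∸ covered u

  cover-≤1 : ∀ u j → cover u j ≤ 1
  cover-≤1 u j with u ≟ a j
  ... | no _    = δ-≤1 u (b j)
  ... | yes u≡a = subst (λ x → 1 + x ≤ 1) (sym (δ-≢ (λ u≡b → adj-≢ G (edge j) (trans (sym u≡a) u≡b)))) (s≤s z≤n)

  cover-endpoint : ∀ {u j} → cover u j ≢ 0 → Endpoint u j
  cover-endpoint {u} {j} = δ-+-nonzero u (a j) (b j)

  cover-unique : ∀ u i j → cover u i ≢ 0 → cover u j ≢ 0 → i ≡ j
  cover-unique u i j ui≢0 uj≢0 with i ≟ j
  ... | yes i≡j = i≡j
  ... | no i≢j  = contradiction refl (disjoint i j i≢j u u (cover-endpoint ui≢0) (cover-endpoint uj≢0))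

  uncovered+covered≡1 : ∀ u → uncovered u + covered u ≡ 1
  uncovered+covered≡1 u = m∸n+n≡m (∑-≤-single (cover u) (cover-≤1 u) (cover-unique u))

  ∑-covered : ∑[ u < n ] covered u ≡ k * 2
  ∑-covered = begin
    ∑[ u < n ] ∑[ j < k ] cover u j                          ≡⟨ ∑-comm cover ⟩
    ∑[ j < k ] ∑[ u < n ] (δ u (a j) + δ u (b j))            ≡⟨ sum-cong-≗ (λ j → ∑-distrib-+ (λ u → δ u (a j)) (λ u → δ u (b j))) ⟩
    ∑[ j < k ] (∑[ u < n ] δ u (a j) + ∑[ u < n ] δ u (b j)) ≡⟨ sum-cong-≗ (λ j → cong₂ _+_ (∑-δ (a j)) (∑-δ (b j))) ⟩
    ∑[ j < k ] 2                                             ≡⟨ ∑-const k 2 ⟩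
    k * 2                                                    ∎
    where open ≡-Reasoning

  weight-uncovered : weight uncovered ≡ n ∸ 2 * k
  weight-uncovered = begin
    weight uncovered                                        ≡⟨ List-sum-allFin uncovered ⟩
    sum uncovered                                           ≡⟨ sym (m+n∸n≡m (sum uncovered) (sum covered)) ⟩
    (sum uncovered + sum covered) ∸ sum covered             ≡⟨ cong₂ _∸_ total ∑-covered ⟩
    n ∸ k * 2                                               ≡⟨ cong (n ∸_) (*-comm k 2) ⟩
    n ∸ 2 * k                                               ∎
    where
    open ≡-Reasoning
    total : sum uncovered + sum covered ≡ n
    total = begin
      sum uncovered + sum covered                 ≡⟨ sym (∑-distrib-+ uncovered covered) ⟩
      ∑[ u < n ] (uncovered u + covered u)        ≡⟨ sum-cong-≗ uncovered+covered≡1 ⟩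
      ∑[ u < n ] 1                                ≡⟨ ∑-const n 1 ⟩
      n * 1                                       ≡⟨ *-identityʳ n ⟩
      n                                           ∎

  partner : ∀ {v j} → Endpoint v j → ∃[ p ] (Adj G v p × (∀ u → Adj G v u → cover u j ≡ δ u p))
  partner {j = j} (inj₁ refl) =
    b j , edge j , λ u vu → cong (_+ δ u (b j)) (δ-≢ (adj-≢ G vu ∘ sym))
  partner {j = j} (inj₂ refl) =
    a j , trans (Graph.sym G (b j) (a j)) (edge j) ,
    λ u vu → trans (cong (δ u (a j) +_) (δ-≢ (adj-≢ G vu ∘ sym))) (+-identityʳ _)

  covered-beside : ∀ {u v j} → Endpoint v j → Adj G v u → covered u ≡ cover u j
  covered-beside {u} {v} {j} vj vu = ∑-single (cover u) j others≡0
    where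
    others≡0 : ∀ i → i ≢ j → cover u i ≡ 0
    others≡0 i i≢j with cover u i ℕ.≟ 0
    ... | yes ui≡0 = ui≡0
    ... | no ui≢0  = contradiction vu (induced j i (i≢j ∘ sym) v u vj (cover-endpoint ui≢0))

  uncovered≡0⇒endpoint : ∀ {v} → uncovered v ≡ 0 → ∃[ j ] Endpoint v j
  uncovered≡0⇒endpoint {v} v≡0 = map₂ cover-endpoint (∑-nonzero (cover v) covered≢0)
    where
    covered≢0 : covered v ≢ 0
    covered≢0 covered≡0 = contradiction (trans (sym v≡0) (cong (1 ∸_) covered≡0)) λ ()

  nbSum-uncovered-endpoint : Cubic G → ∀ {v j} → Endpoint v j → nbSum G uncovered v ≡ 2
  nbSum-uncovered-endpoint cubic {v} {j} vj with partner vj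
  ... | p , vp , cover≡δ = +-cancelʳ-≡ 1 _ 2 (begin
    nbSum G uncovered v + 1                          ≡⟨ cong (nbSum G uncovered v +_) (sym (nbSum-δ G vp)) ⟩
    nbSum G uncovered v + nbSum G (λ u → δ u p) v    ≡⟨ nbSum-complement G uncovered (λ u → δ u p) v complement ⟩
    degree G v                                       ≡⟨ cubic v ⟩
    3                                                ∎)
    where
    open ≡-Reasoning
    complement : ∀ u → Adj G v u → uncovered u + δ u p ≡ 1
    complement u vu = begin
      uncovered u + δ u p        ≡⟨ cong (uncovered u +_) (sym (cover≡δ u vu)) ⟩
      uncovered u + cover u j    ≡⟨ cong (uncovered u +_) (sym (covered-beside vj vu)) ⟩
      uncovered u + covered u    ≡⟨ uncovered+covered≡1 u ⟩
      1                          ∎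

  uncovered-isPID : Cubic G → IsPID G uncovered
  uncovered-isPID cubic = record
    { range   = λ v → ≤-trans (m∸n≤m 1 (covered v)) (s≤s z≤n)
    ; perfect = λ v v≡0 → nbSum-uncovered-endpoint cubic (proj₂ (uncovered≡0⇒endpoint v≡0))
    }

lemma27 : (n : ℕ) (G : Graph n) → Cubic G →
    (k : ℕ) (M : Fin k → Fin n × Fin n) → IsStrongMatching G M →
    Σ (Fin n → ℕ) (λ f → IsPID G f × weight f ≤ n ∸ 2 * k)
lemma27 n G cubic k M strong =
  uncovered , uncovered-isPID cubic , ≤-reflexive weight-uncovered
  where open Uncovered strong
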